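{- For every tree $T$, the numbers $\mathrm{sn}(T,k)$ are monotone non-decreasing in $k$, i.e. $\mathrm{sn}(T,k)\le\mathrm{sn}(T,k+1)$ for every integer $k\ge\chi(T)$.
   Context: For a graph $G=(V,E)$ and an integer $k\ge\chi(G)$, a proper $k$-colouring is a map $c\colon V\to\{1,\dots,k\}$ with adjacent vertices receiving different colours. $\mathrm{sn}(G,k)$ is the minimum number of vertices coloured in a partial colouring of $G$ that has a unique extension to a proper $k$-colouring of $G$. -}

module Defs where

open import Data.Nat using (ℕ; zero; suc; _+_; _≤_; _<_)
open import Data.Fin using (Fin; zero; suc)
open import Data.Maybe using (Maybe; just; nothing)
open import Data.List using (List; []; _∷_; length; last)
open import Data.List.Relation.Unary.Unique.Propositional using (Unique)
open import Data.Product using (Σ; ∃; ∃-syntax; _×_; _,_)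
open import Relation.Nullary using (¬_)
open import Data.Empty using (⊥)
open import Relation.Binary.PropositionalEquality using (_≡_)
open import Level using (0ℓ) renaming (suc to lsuc)

record Graph (n : ℕ) : Set₁ where
  field
    Adj    : Fin n → Fin n → Set
    sym    : ∀ {u v} → Adj u v → Adj v u
    irrefl : ∀ {v} → ¬ Adj v v
open Graph public

module _ {n : ℕ} (G : Graph n) where

  data Walk : Fin n → Fin n → Set where
    here : ∀ {u} → Walk u u
    step : ∀ {u w v} → Adj G u w → Walk w v → Walk u v

  Connected : Set
  Connected = ∀ u v → Walk u v

  data Chain : List (Fin n) → Set where
    nil  : Chain []
    one  : ∀ {v} → Chain (v ∷ [])
    cons : ∀ {u v vs} → Adj G u v → Chain (v ∷ vs) → Chain (u ∷ v ∷ vs)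

  IsCycle : List (Fin n) → Set
  IsCycle [] = ⊥
  IsCycle (v₀ ∷ vs) =
    3 ≤ length (v₀ ∷ vs) × Unique (v₀ ∷ vs) × Chain (v₀ ∷ vs)
    × Σ (Fin n) (λ vₘ → last (v₀ ∷ vs) ≡ just vₘ × Adj G vₘ v₀)

  Acyclic : Set
  Acyclic = ∀ vs → ¬ IsCycle vs

IsTree : ∀ {n} → Graph n → Set
IsTree {n} G = 1 ≤ n × Connected G × Acyclic G

module _ {n : ℕ} (G : Graph n) where

  -- proper k-colouring (colours Fin k, i.e. {1,…,k} shifted by one)
  Proper : (k : ℕ) → (Fin n → Fin k) → Set
  Proper k c = ∀ u v → Adj G u v → ¬ (c u ≡ c v)

  Colourable : ℕ → Set
  Colourable k = Σ (Fin n → Fin k) (Proper k)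

  IsChromaticNumber : ℕ → Set
  IsChromaticNumber χ = Colourable χ × (∀ k → Colourable k → χ ≤ k)

  Extends : ∀ {k} → (Fin n → Fin k) → (Fin n → Maybe (Fin k)) → Set
  Extends c p = ∀ v a → p v ≡ just a → c v ≡ a

  UniqueExtension : (k : ℕ) → (Fin n → Maybe (Fin k)) → Set
  UniqueExtension k p =
    Σ (Fin n → Fin k) (λ c → Proper k c × Extends c p)
    × (∀ c c' → Proper k c → Extends c p → Proper k c' → Extends c' p
         → ∀ v → c v ≡ c' v)

numColoured : ∀ {n} {A : Set} → (Fin n → Maybe A) → ℕ
numColoured {zero}  p = 0
numColoured {suc n} p with p zero
... | just _  = suc (numColoured (λ i → p (suc i)))
... | nothing = numColoured (λ i → p (suc i))

IsSN : ∀ {n} → Graph n → ℕ → ℕ → Set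
IsSN G k s =
  Σ _ (λ p → UniqueExtension G k p × numColoured p ≡ s)
  × (∀ p → UniqueExtension G k p → s ≤ numColoured p)

module Submission where

-- Let p′ be a partial colouring whose unique proper extension c₁ uses k + 1 colours. In a tree
-- every vertex is then forced: it is precoloured, or every other colour sits on a forced
-- neighbour; otherwise recolouring the unforced vertices top-down with "escape" colours gives a
-- second extension. Rooting the tree, c₁ is turned into a k-colouring c vertex by vertex: around
-- each vertex v a surjection from the colours other than c₁ v onto those other than c v, fixed on
-- the parent, carries the colours of the neighbours. Forcing is carried along, so precolouring
-- the vertices of p′ by c gives a partial colouring of the same size uniquely extending to c.
-- Decidability of adjacency and of forcing is only available classically, which is harmless
-- because the conclusion s ≤ s′ is decidable.

open import Defs renaming (sym to adj-sym)
open import Data.Nat using (ℕ; zero; suc; _≤_; _<_; _≤?_; s≤s; z≤n)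
open import Data.Nat.Properties
  using (≤-trans; ≤-reflexive; ≤-antisym; ≮⇒≥; ≤-total; <-irrefl; <-≤-trans; <⇒≤)
open import Data.Fin using (Fin; zero; suc; punchIn; punchOut)
open import Data.Fin.Properties
  using (_≟_; ¬Fin0; any?; ¬∀⟶∃¬; punchInᵢ≢i; punchIn-punchOut; punchOut-punchIn; punchOut-cong)
open import Data.Maybe using (Maybe; just; nothing)
import Data.Maybe as Maybe
open import Data.List using (List; []; _∷_; last)
import Data.List.Membership.DecPropositional
open import Data.List.Membership.Propositional using (_∈_; _∉_)
open import Data.List.Relation.Unary.Any using (here; there)
open import Data.List.Relation.Unary.All using (All; []; _∷_)
import Data.List.Relation.Unary.All as All
open import Data.List.Relation.Unary.All.Properties using (¬Any⇒All¬)
open import Data.List.Relation.Unary.AllPairs using ([]; _∷_)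
open import Data.List.Relation.Unary.Unique.Propositional using (Unique)
open import Function using (_∘_; _$_; id; flip)
open import Data.Product using (Σ; ∃; _×_; _,_; proj₁; proj₂; map₂)
open import Data.Sum using (_⊎_; inj₁; inj₂; [_,_])
import Data.Sum as Sum
open import Data.Empty using (⊥; ⊥-elim)
open import Relation.Nullary using (¬_; Dec; yes; no; contradiction)
open import Relation.Nullary.Decidable using (_×-dec_; _⊎-dec_; ¬¬-excluded-middle; decidable-stable)
open import Relation.Nullary.Negation using (¬¬-Monad; ¬¬-map)
open import Effect.Monad using (RawMonad)
open import Relation.Unary using (Decidable)
open import Relation.Binary.PropositionalEquality
  using (_≡_; _≢_; refl; sym; trans; cong; subst; ≢-sym; module ≡-Reasoning)

minimalWitness : {P : ℕ → Set} → Decidable P → ∀ {j} → P j →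
                 ∃ λ m → P m × (∀ i → i < m → ¬ P i)
minimalWitness P? {zero} p = zero , p , λ _ ()
minimalWitness P? {suc j} p with P? zero
... | yes p₀ = zero , p₀ , λ _ ()
... | no ¬p₀ with minimalWitness (λ i → P? (suc i)) p
...   | m , pm , below = suc m , pm , λ { zero _ → ¬p₀ ; (suc i) (s≤s i<m) → below i i<m }

collapse : ∀ {m} → Fin (suc (suc m)) → Fin (suc m) → Fin (suc (suc m)) → Fin (suc m)
collapse i j x with i ≟ x
... | yes _   = j
... | no i≢x = punchOut i≢x

collapse-self : ∀ {m} (i : Fin (suc (suc m))) j → collapse i j i ≡ j
collapse-self i j with i ≟ i
... | yes _   = refl
... | no i≢i = contradiction refl i≢i

collapse-punchIn : ∀ {m} (i : Fin (suc (suc m))) j y → collapse i j (punchIn i y) ≡ y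
collapse-punchIn i j y with i ≟ punchIn i y
... | yes i≡ = contradiction (sym i≡) (punchInᵢ≢i i y)
... | no _   = trans (punchOut-cong i refl) (punchOut-punchIn i)

punchIn-collapse : ∀ {m} (i : Fin (suc (suc m))) j {x} → i ≢ x → punchIn i (collapse i j x) ≡ x
punchIn-collapse i j {x} i≢x with i ≟ x
... | yes i≡x = contradiction i≡x i≢x
... | no i≢x′ = punchIn-punchOut i≢x′

relabel : ∀ {m} (a : Fin (suc (suc (suc m)))) (b : Fin (suc (suc m)))
          (a′ : Fin (suc (suc (suc m)))) (b′ : Fin (suc (suc m))) →
          Fin (suc (suc (suc m))) → Fin (suc (suc m))
relabel a b a′ b′ x = punchIn b (collapse (collapse a zero a′) (collapse b zero b′) (collapse a zero x))

module _ {m} (a : Fin (suc (suc (suc m)))) (b : Fin (suc (suc m)))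
         (a′ : Fin (suc (suc (suc m)))) (b′ : Fin (suc (suc m))) where
  open ≡-Reasoning

  relabel-avoids : ∀ x → relabel a b a′ b′ x ≢ b
  relabel-avoids x = punchInᵢ≢i b _

  relabel-onto : ∀ y → b ≢ y → ∃ λ x → a ≢ x × relabel a b a′ b′ x ≡ y
  relabel-onto y b≢y = x , ≢-sym (punchInᵢ≢i a _) , hits
    where
    i : Fin (suc (suc m))
    i = collapse a zero a′
    j : Fin (suc m)
    j = collapse b zero b′
    x : Fin (suc (suc (suc m)))
    x = punchIn a (punchIn i (collapse b zero y))
    hits : relabel a b a′ b′ x ≡ y
    hits = begin
      punchIn b (collapse i j (collapse a zero (punchIn a (punchIn i (collapse b zero y)))))
        ≡⟨ cong (λ z → punchIn b (collapse i j z)) (collapse-punchIn a zero _) ⟩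
      punchIn b (collapse i j (punchIn i (collapse b zero y)))
        ≡⟨ cong (punchIn b) (collapse-punchIn i j _) ⟩
      punchIn b (collapse b zero y)
        ≡⟨ punchIn-collapse b zero b≢y ⟩
      y ∎

  relabel-sends : a ≢ a′ → b ≢ b′ → relabel a b a′ b′ a′ ≡ b′
  relabel-sends a≢a′ b≢b′ = begin
    punchIn b (collapse i j i) ≡⟨ cong (punchIn b) (collapse-self i j) ⟩
    punchIn b j                ≡⟨ punchIn-collapse b zero b≢b′ ⟩
    b′ ∎
    where
    i : Fin (suc (suc m))
    i = collapse a zero a′
    j : Fin (suc m)
    j = collapse b zero b′

module Walks {n} (G : Graph n) where

  data WalkWithin (P : Fin n → Set) : Fin n → Fin n → Set where
    stop : ∀ {u} → P u → WalkWithin P u u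
    go   : ∀ {u w v} → P u → Adj G u w → WalkWithin P w v → WalkWithin P u v

  module _ {P : Fin n → Set} where

    _++ʷ_ : ∀ {u v w} → WalkWithin P u v → WalkWithin P v w → WalkWithin P u w
    stop _      ++ʷ ω = ω
    go pu a ω′ ++ʷ ω = go pu a (ω′ ++ʷ ω)

    reverseʷ : ∀ {u v} → WalkWithin P u v → WalkWithin P v u
    reverseʷ (stop pu)  = stop pu
    reverseʷ (go pu a ω) = reverseʷ ω ++ʷ go (first ω) (adj-sym G a) (stop pu)
      where
      first : ∀ {x y} → WalkWithin P x y → P x
      first (stop px)     = px
      first (go px _ _) = px

    record SimplePathWithin (u v : Fin n) : Set where
      constructor path
      field
        tail   : List (Fin n)
        unique : Unique (u ∷ tail)
        chain  : Chain G (u ∷ tail)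
        ends   : last (u ∷ tail) ≡ just v
        within : All P (u ∷ tail)

    open Data.List.Membership.DecPropositional (_≟_ {n}) using (_∈?_)

    suffixFrom : ∀ {x u v} (π : SimplePathWithin x v) → u ∈ x ∷ SimplePathWithin.tail π →
                 SimplePathWithin u v
    suffixFrom π (here refl) = π
    suffixFrom (path (y ∷ ys) (_ ∷ uq) (cons _ ch) ends (_ ∷ pys)) (there u∈) =
      suffixFrom (path ys uq ch ends pys) u∈

    prepend : ∀ {u w v} → P u → Adj G u w → (π : SimplePathWithin w v) →
              u ∉ w ∷ SimplePathWithin.tail π → SimplePathWithin u v
    prepend pu a (path tl uq ch ends pw) u∉ =
      path (_ ∷ tl) (¬Any⇒All¬ _ u∉ ∷ uq) (cons a ch) ends (pu ∷ pw)

    eraseLoops : ∀ {u v} → WalkWithin P u v → SimplePathWithin u v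
    eraseLoops (stop pu) = path [] ([] ∷ []) one refl (pu ∷ [])
    eraseLoops {u} (go {w = w} pu a ω) with eraseLoops ω
    ... | π with u ∈? w ∷ SimplePathWithin.tail π
    ...   | yes u∈ = suffixFrom π u∈
    ...   | no u∉  = prepend pu a π u∉

  acyclic⇒no-detour : Acyclic G → ∀ {w u q} → Adj G w u → Adj G w q → u ≢ q →
                      ¬ WalkWithin (_≢ w) u q
  acyclic⇒no-detour acyclic {w} {u} {q} wu wq u≢q ω with eraseLoops ω
  ... | path [] _ _ refl _ = u≢q refl
  ... | path (t ∷ ts) uq ch ends avoid =
    acyclic (w ∷ u ∷ t ∷ ts)
      (s≤s (s≤s (s≤s z≤n)) , All.map ≢-sym avoid ∷ uq , cons wu ch , q , ends , adj-sym G wq)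

record Rooting {n} (G : Graph n) : Set where
  field
    depth       : Fin n → ℕ
    parent      : Fin n → Fin n
    parent-edge : ∀ {v f} → depth v ≡ suc f → depth (parent v) ≡ f × Adj G (parent v) v
    edge-parent : ∀ {u v} → Adj G u v → depth u ≤ depth v → parent v ≡ u × depth v ≡ suc (depth u)

module BreadthFirst {n} (G : Graph (suc n)) (adj? : ∀ u v → Dec (Adj G u v))
                    (connected : Connected G) (acyclic : Acyclic G) where
  open Walks G

  root : Fin (suc n)
  root = zero

  Within : ℕ → Fin (suc n) → Set
  Within zero    v = v ≡ root
  Within (suc i) v = Within i v ⊎ ∃ λ u → Within i u × Adj G u v

  within? : ∀ i → Decidable (Within i)
  within? zero    v = v ≟ root
  within? (suc i) v = within? i v ⊎-dec any? (λ u → within? i u ×-dec adj? u v)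

  reachable-within : ∀ {u v} → Walk G u v → ∀ {i} → Within i u → ∃ λ j → Within j v
  reachable-within here       {i} w = i , w
  reachable-within (step a ω) {i} w = reachable-within ω {suc i} (inj₂ (_ , w , a))

  closest : ∀ v → ∃ λ m → Within m v × (∀ i → i < m → ¬ Within i v)
  closest v = minimalWitness (λ i → within? i v) (proj₂ (reachable-within (connected root v) refl))

  depth : Fin (suc n) → ℕ
  depth v = proj₁ (closest v)

  within-depth : ∀ v → Within (depth v) v
  within-depth v = proj₁ (proj₂ (closest v))

  depth-minimal : ∀ {i v} → Within i v → depth v ≤ i
  depth-minimal {i} {v} w = ≮⇒≥ (λ i<d → proj₂ (proj₂ (closest v)) i i<d w)

  depth-zero : ∀ {v} → depth v ≡ 0 → v ≡ root
  depth-zero {v} d≡0 = subst (λ i → Within i v) d≡0 (within-depth v)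

  depth-adj : ∀ {u v} → Adj G u v → depth v ≤ suc (depth u)
  depth-adj {u} a = depth-minimal (inj₂ (u , within-depth u , a))

  parentAt : ∀ v i → depth v ≡ i →
             Σ (Fin (suc n)) λ u → ∀ {f} → i ≡ suc f → depth u ≡ f × Adj G u v
  parentAt v zero    _  = v , λ ()
  parentAt v (suc i) d≡ with subst (λ j → Within j v) d≡ (within-depth v)
  ... | inj₁ w = contradiction (subst (_≤ i) d≡ (depth-minimal w)) (<-irrefl refl)
  ... | inj₂ (u , w , a) = u , λ { refl → ≤-antisym (depth-minimal w) (≮⇒≥ shallower) , a }
    where
    shallower : depth u < i → ⊥
    shallower du<i = <-irrefl refl (subst (_≤ i) d≡ (≤-trans (depth-adj a) du<i))

  parent : Fin (suc n) → Fin (suc n)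
  parent v = proj₁ (parentAt v (depth v) refl)

  parent-edge : ∀ {v f} → depth v ≡ suc f → depth (parent v) ≡ f × Adj G (parent v) v
  parent-edge {v} = proj₂ (parentAt v (depth v) refl)

  parent-shallower : ∀ {v f} → depth v ≡ suc f → depth (parent v) < depth v
  parent-shallower {v} d≡ =
    subst (depth (parent v) <_) (sym d≡) (s≤s (≤-reflexive (proj₁ (parent-edge d≡))))

  shallower⇒≢ : ∀ {u w} → depth u < depth w → u ≢ w
  shallower⇒≢ u<w refl = <-irrefl refl u<w

  ascend : ∀ {w} f u → depth u ≡ f → u ≢ w → depth u ≤ depth w → WalkWithin (_≢ w) u root
  ascend zero    u d≡0 u≢w _   = subst (WalkWithin _ u) (depth-zero d≡0) (stop u≢w)
  ascend {w} (suc f) u d≡ u≢w u≤w =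
    go u≢w (adj-sym G (proj₂ (parent-edge d≡)))
       (ascend f (parent u) (proj₁ (parent-edge d≡)) (shallower⇒≢ p<w) (<⇒≤ p<w))
    where
    p<w : depth (parent u) < depth w
    p<w = <-≤-trans (parent-shallower d≡) u≤w

  edge-parent : ∀ {u v} → Adj G u v → depth u ≤ depth v → parent v ≡ u × depth v ≡ suc (depth u)
  edge-parent {u} {v} a u≤v = byDepth (depth v) refl
    where
    u≢v : u ≢ v
    u≢v refl = irrefl G a

    byDepth : ∀ d → depth v ≡ d → parent v ≡ u × depth v ≡ suc (depth u)
    byDepth zero d≡ =
      contradiction (trans (depth-zero u≡0) (sym (depth-zero d≡))) u≢v
      where
      u≡0 : depth u ≡ 0
      u≡0 = ≤-antisym (≤-trans u≤v (≤-reflexive d≡)) z≤n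
    byDepth (suc f) d≡ with parent v ≟ u
    ... | yes refl = refl , trans d≡ (cong suc (sym (proj₁ (parent-edge d≡))))
    ... | no q≢u = contradiction detour
      (acyclic⇒no-detour acyclic (adj-sym G a) (adj-sym G (proj₂ (parent-edge d≡))) (≢-sym q≢u))
      where
      q<v : depth (parent v) < depth v
      q<v = parent-shallower d≡
      detour : WalkWithin (_≢ v) u (parent v)
      detour = ascend _ u refl u≢v u≤v
           ++ʷ reverseʷ (ascend _ (parent v) refl (shallower⇒≢ q<v) (<⇒≤ q<v))

  rooting : Rooting G
  rooting = record
    { depth = depth ; parent = parent ; parent-edge = parent-edge ; edge-parent = edge-parent }

module Forcing {n} (G : Graph n) {k} (c : Fin n → Fin k) (p : Fin n → Maybe (Fin k)) where

  data Forced : Fin n → Set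

  ForcedNeighbour : Fin n → Fin k → Set
  ForcedNeighbour v a = ∃ λ u → Adj G v u × Forced u × c u ≡ a

  data Forced where
    coloured   : ∀ {v a} → p v ≡ just a → Forced v
    surrounded : ∀ {v} → (∀ a → a ≢ c v → ForcedNeighbour v a) → Forced v

  forced⇒agrees : Extends G c p → ∀ {d} → Proper G k d → Extends G d p →
                  ∀ {v} → Forced v → d v ≡ c v
  forced⇒agrees c-ext _ d-ext (coloured {v} {a} pv≡a) = trans (d-ext v a pv≡a) (sym (c-ext v a pv≡a))
  forced⇒agrees c-ext {d} d-proper d-ext (surrounded {v} nbrs) with d v ≟ c v
  ... | yes dv≡cv = dv≡cv
  ... | no dv≢cv with nbrs (d v) dv≢cv
  ...   | u , vu , forced-u , cu≡dv =
    contradiction (sym (trans (forced⇒agrees c-ext d-proper d-ext forced-u) cu≡dv)) (d-proper v u vu)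

module UniquelyExtended {n} {G : Graph n} (R : Rooting G) (adj? : ∀ u v → Dec (Adj G u v))
                        {K} {p : Fin n → Maybe (Fin K)} (unique : UniqueExtension G K p)
                        (forced? : ∀ v → Dec (Forcing.Forced G (proj₁ (proj₁ unique)) p v)) where
  open Rooting R

  c : Fin n → Fin K
  c = proj₁ (proj₁ unique)

  c-proper : Proper G K c
  c-proper = proj₁ (proj₂ (proj₁ unique))

  c-extends : Extends G c p
  c-extends = proj₂ (proj₂ (proj₁ unique))

  open Forcing G c p

  escape : ∀ {w} → ¬ Forced w → ∃ λ a → a ≢ c w × ¬ ForcedNeighbour w a
  escape {w} unforced with ¬∀⟶∃¬ K (λ a → a ≡ c w ⊎ ForcedNeighbour w a) options (unforced ∘ surround)
    where
    options : ∀ a → Dec (a ≡ c w ⊎ ForcedNeighbour w a)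
    options a = (a ≟ c w) ⊎-dec any? (λ u → adj? w u ×-dec forced? u ×-dec (c u ≟ a))
    surround : (∀ a → a ≡ c w ⊎ ForcedNeighbour w a) → Forced w
    surround all = surrounded λ a a≢cw → [ flip contradiction a≢cw , id ] (all a)
  ... | a , neither = a , neither ∘ inj₁ , neither ∘ inj₂

  altColour : Fin n → Fin K
  altColour w with forced? w
  ... | yes _        = c w
  ... | no unforced = proj₁ (escape unforced)

  altColour-escapes : ∀ {w} → ¬ Forced w → altColour w ≢ c w × ¬ ForcedNeighbour w (altColour w)
  altColour-escapes {w} unforced with forced? w
  ... | yes forced    = contradiction forced unforced
  ... | no unforced′ = proj₂ (escape unforced′)

  module Recolouring (alt : Fin n → Fin K)
                     (alt-escapes : ∀ {w} → ¬ Forced w → alt w ≢ c w × ¬ ForcedNeighbour w (alt w)) where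

    recolour : ℕ → Fin n → Fin K
    recolour f w with forced? w
    ... | yes _ = c w
    recolour zero    w | no _ = alt w
    recolour (suc f) w | no _ with recolour f (parent w) ≟ alt w
    ... | yes _ = c w
    ... | no _  = alt w

    recolour-forced : ∀ {f w} → Forced w → recolour f w ≡ c w
    recolour-forced {f} {w} forced with forced? w
    ... | yes _        = refl
    ... | no unforced = contradiction forced unforced

    recolour-root : ∀ {w} → ¬ Forced w → recolour zero w ≡ alt w
    recolour-root {w} unforced with forced? w
    ... | yes forced = contradiction forced unforced
    ... | no _       = refl

    recolour-child : ∀ {f w} → ¬ Forced w →
      (recolour f (parent w) ≡ alt w × recolour (suc f) w ≡ c w) ⊎
      (recolour f (parent w) ≢ alt w × recolour (suc f) w ≡ alt w)
    recolour-child {f} {w} unforced with forced? w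
    ... | yes forced = contradiction forced unforced
    ... | no _ with recolour f (parent w) ≟ alt w
    ...   | yes clash = inj₁ (clash , refl)
    ...   | no fine   = inj₂ (fine , refl)

    recolour-unforced : ∀ f {w} → ¬ Forced w → recolour f w ≡ c w ⊎ recolour f w ≡ alt w
    recolour-unforced zero    unforced = inj₂ (recolour-root unforced)
    recolour-unforced (suc f) unforced = Sum.map proj₂ proj₂ (recolour-child unforced)

    recolour-options : ∀ f w → recolour f w ≡ c w ⊎ (¬ Forced w × recolour f w ≡ alt w)
    recolour-options f w = byForced (forced? w)
      where
      byForced : Dec (Forced w) → recolour f w ≡ c w ⊎ (¬ Forced w × recolour f w ≡ alt w)
      byForced (yes forced)  = inj₁ (recolour-forced forced)
      byForced (no unforced) = Sum.map₂ (unforced ,_) (recolour-unforced f unforced)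

    recolour-proper : ∀ {f w} → Adj G (parent w) w → recolour f (parent w) ≢ recolour (suc f) w
    recolour-proper {f} {w} qw = byForced (forced? w)
      where
      byForced : Dec (Forced w) → recolour f (parent w) ≢ recolour (suc f) w
      byForced (yes fw) rq≡rw with recolour-options f (parent w)
      ... | inj₁ rq≡c          = c-proper _ _ qw (trans (sym rq≡c) (trans rq≡rw (recolour-forced fw)))
      ... | inj₂ (uq , rq≡alt) =
        proj₂ (alt-escapes uq) (w , qw , fw , trans (sym (recolour-forced fw)) (trans (sym rq≡rw) rq≡alt))
      byForced (no uw) rq≡rw with recolour-child {f} uw
      ... | inj₁ (rq≡alt , rw≡c)   = proj₁ (alt-escapes uw) (trans (sym rq≡alt) (trans rq≡rw rw≡c))
      ... | inj₂ (rq≢alt , rw≡alt) = rq≢alt (trans rq≡rw rw≡alt)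

    recoloured : Fin n → Fin K
    recoloured w = recolour (depth w) w

    recoloured-parent : ∀ {u v} → Adj G u v → parent v ≡ u × depth v ≡ suc (depth u) →
                        recoloured u ≢ recoloured v
    recoloured-parent {v = v} uv (refl , d≡) =
      subst (λ i → recoloured (parent v) ≢ recolour i v) (sym d≡) (recolour-proper uv)

    recoloured-proper : Proper G K recoloured
    recoloured-proper u v uv with ≤-total (depth u) (depth v)
    ... | inj₁ u≤v = recoloured-parent uv (edge-parent uv u≤v)
    ... | inj₂ v≤u = ≢-sym (recoloured-parent (adj-sym G uv) (edge-parent (adj-sym G uv) v≤u))

    recoloured-extends : Extends G recoloured p
    recoloured-extends v a pv≡a = trans (recolour-forced (coloured pv≡a)) (c-extends v a pv≡a)

    unforced-recoloured : (∀ v → recoloured v ≡ c v) → ∀ f {w} → depth w ≡ f → ¬ Forced w → ⊥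
    unforced-recoloured same = go
      where
      same-at : ∀ {f w} → depth w ≡ f → recolour f w ≡ c w
      same-at {w = w} d≡ = trans (cong (λ i → recolour i w) (sym d≡)) (same w)

      go : ∀ f {w} → depth w ≡ f → ¬ Forced w → ⊥
      go zero    d≡ uw = proj₁ (alt-escapes uw) (trans (sym (recolour-root uw)) (same-at d≡))
      go (suc f) {w} d≡ uw with recolour-child {f} uw
      ... | inj₂ (_ , rw≡alt) = proj₁ (alt-escapes uw) (trans (sym rw≡alt) (same-at d≡))
      ... | inj₁ (rq≡alt , _) = go f (proj₁ (parent-edge d≡)) uq
        where
        uq : ¬ Forced (parent w)
        uq fq = proj₂ (alt-escapes uw)
          (parent w , adj-sym G (proj₂ (parent-edge d≡)) , fq , trans (sym (same-at (proj₁ (parent-edge d≡)))) rq≡alt)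

  all-forced : ∀ v → Forced v
  all-forced v with forced? v
  ... | yes forced  = forced
  ... | no unforced = ⊥-elim $
    unforced-recoloured (proj₂ unique recoloured c recoloured-proper recoloured-extends c-proper c-extends)
                        (depth v) refl unforced
    where open Recolouring altColour altColour-escapes

numColoured-map : ∀ {n} {A B : Set} (p : Fin n → Maybe A) (f : Fin n → A → B) →
                  numColoured (λ v → Maybe.map (f v) (p v)) ≡ numColoured p
numColoured-map {zero}  p f = refl
numColoured-map {suc n} p f with p zero
... | just _  = cong suc (numColoured-map (p ∘ suc) (f ∘ suc))
... | nothing = numColoured-map (p ∘ suc) (f ∘ suc)

map-const-just : ∀ {A B : Set} {b a : B} (x : Maybe A) → Maybe.map (λ _ → b) x ≡ just a → b ≡ a
map-const-just (just _) refl = refl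

module Relabelled {n} {G : Graph n} (R : Rooting G) {m} {c₁ : Fin n → Fin (suc (suc (suc m)))}
                  (c₁-proper : Proper G _ c₁) where
  open Rooting R

  -- The root gets colour zero arbitrarily; parentColourAt zero is a junk value, as the root has
  -- no parent.
  mutual
    colourAt : ℕ → Fin n → Fin (suc (suc m))
    colourAt zero    w = zero
    colourAt (suc f) w = relabelAt f (parent w) (c₁ w)

    relabelAt : ℕ → Fin n → Fin (suc (suc (suc m))) → Fin (suc (suc m))
    relabelAt f q = relabel (c₁ q) (colourAt f q) (c₁ (parent q)) (parentColourAt f q)

    parentColourAt : ℕ → Fin n → Fin (suc (suc m))
    parentColourAt zero    q = zero
    parentColourAt (suc f) q = colourAt f (parent q)

  colour : Fin n → Fin (suc (suc m))
  colour w = colourAt (depth w) w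

  colourAt-depth : ∀ {w f} → depth w ≡ f → colourAt f w ≡ colour w
  colourAt-depth {w} d≡ = cong (λ i → colourAt i w) (sym d≡)

  relabelling : Fin n → Fin (suc (suc (suc m))) → Fin (suc (suc m))
  relabelling q = relabelAt (depth q) q

  relabelling-avoids : ∀ q x → relabelling q x ≢ colour q
  relabelling-avoids q = relabel-avoids (c₁ q) (colour q) (c₁ (parent q)) (parentColourAt (depth q) q)

  relabelling-onto : ∀ q y → colour q ≢ y → ∃ λ x → c₁ q ≢ x × relabelling q x ≡ y
  relabelling-onto q = relabel-onto (c₁ q) (colour q) (c₁ (parent q)) (parentColourAt (depth q) q)

  colour-child : ∀ {w f} → depth w ≡ suc f → colour w ≡ relabelling (parent w) (c₁ w)
  colour-child {w} d≡ =
    trans (cong (λ i → colourAt i w) d≡) (cong (λ i → relabelAt i (parent w) (c₁ w)) (sym (proj₁ (parent-edge d≡))))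

  colour-parent-distinct : ∀ {w f} → depth w ≡ suc f → colour w ≢ colour (parent w)
  colour-parent-distinct {w} d≡ cw≡cq =
    relabelling-avoids (parent w) (c₁ w) (trans (sym (colour-child d≡)) cw≡cq)

  relabelling-parent : ∀ {v f} → depth v ≡ suc f → relabelling v (c₁ (parent v)) ≡ colour (parent v)
  relabelling-parent {v} d≡ = trans
    (relabel-sends (c₁ v) (colour v) (c₁ (parent v)) (parentColourAt (depth v) v)
      (≢-sym (c₁-proper _ _ qv)) (colour-parent-distinct d≡ ∘ flip trans pc≡))
    pc≡
    where
    qv : Adj G (parent v) v
    qv = proj₂ (parent-edge d≡)
    pc≡ : parentColourAt (depth v) v ≡ colour (parent v)
    pc≡ = trans (cong (λ i → parentColourAt i v) d≡) (colourAt-depth (proj₁ (parent-edge d≡)))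

  colour-neighbour : ∀ {v u} → Adj G v u → colour u ≡ relabelling v (c₁ u)
  colour-neighbour {v} {u} vu with ≤-total (depth v) (depth u)
  ... | inj₁ v≤u with edge-parent vu v≤u
  ...   | refl , d≡ = colour-child d≡
  colour-neighbour {v} {u} vu | inj₂ u≤v with edge-parent (adj-sym G vu) u≤v
  ...   | refl , d≡ = sym (relabelling-parent d≡)

  colour-proper : Proper G _ colour
  colour-proper u v uv cu≡cv = relabelling-avoids u (c₁ v) (trans (sym (colour-neighbour uv)) (sym cu≡cv))

  module _ (p₁ : Fin n → Maybe (Fin (suc (suc (suc m))))) where

    p : Fin n → Maybe (Fin (suc (suc m)))
    p v = Maybe.map (λ _ → colour v) (p₁ v)

    forced-transfer : ∀ {v} → Forcing.Forced G c₁ p₁ v → Forcing.Forced G colour p v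
    forced-transfer (Forcing.coloured p₁v≡a) = Forcing.coloured (cong (Maybe.map _) p₁v≡a)
    forced-transfer {v} (Forcing.surrounded nbrs) = Forcing.surrounded λ b b≢cv → neighbour b (≢-sym b≢cv)
      where
      neighbour : ∀ b → colour v ≢ b → Forcing.ForcedNeighbour G colour p v b
      neighbour b cv≢b with relabelling-onto v b cv≢b
      ... | x , c₁v≢x , gx≡b with nbrs x (≢-sym c₁v≢x)
      ...   | u , vu , forced-u , c₁u≡x =
        u , vu , forced-transfer forced-u , trans (colour-neighbour vu) (trans (cong (relabelling v) c₁u≡x) gx≡b)

    colour-extends : Extends G colour p
    colour-extends v a pv≡a = map-const-just (p₁ v) pv≡a

    unique-extension : (∀ v → Forcing.Forced G c₁ p₁ v) → UniqueExtension G _ p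
    unique-extension all-forced =
      (colour , colour-proper , colour-extends) ,
      λ d d′ d-proper d-ext d′-proper d′-ext v → trans (agrees d-proper d-ext v) (sym (agrees d′-proper d′-ext v))
      where
      agrees : ∀ {d} → Proper G _ d → Extends G d p → ∀ v → d v ≡ colour v
      agrees d-proper d-ext v =
        Forcing.forced⇒agrees G colour p colour-extends d-proper d-ext (forced-transfer (all-forced v))

¬¬-∀-Fin : ∀ {n} {P : Fin n → Set} → (∀ i → ¬ ¬ P i) → ¬ ¬ (∀ i → P i)
¬¬-∀-Fin {zero}  _ ¬all = ¬all λ ()
¬¬-∀-Fin {suc n} h ¬all =
  h zero λ p₀ → ¬¬-∀-Fin (h ∘ suc) λ ps → ¬all λ { zero → p₀ ; (suc i) → ps i }

¬¬-decidable : ∀ {n} {P : Fin n → Set} → ¬ ¬ (∀ i → Dec (P i))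
¬¬-decidable = ¬¬-∀-Fin (λ _ → ¬¬-excluded-middle)

tree-drop-colour : ∀ {n m} {G : Graph (suc n)} → Connected G → Acyclic G →
                   ∀ {p₁} → UniqueExtension G (suc (suc (suc m))) p₁ →
                   ¬ ¬ (∃ λ p → UniqueExtension G (suc (suc m)) p × numColoured p ≡ numColoured p₁)
tree-drop-colour {G = G} connected acyclic {p₁} unique = do
  adj?    ← ¬¬-∀-Fin λ _ → ¬¬-decidable
  forced? ← ¬¬-decidable
  let R = BreadthFirst.rooting G adj? connected acyclic
      open Relabelled R (proj₁ (proj₂ (proj₁ unique)))
  pure (p p₁ , unique-extension p₁ (UniquelyExtended.all-forced R adj? unique forced?) , numColoured-map p₁ _)
  where open RawMonad ¬¬-Monad

numColoured-nothing : ∀ {n} {A : Set} → numColoured {n} {A} (λ _ → nothing) ≡ 0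
numColoured-nothing {zero}  = refl
numColoured-nothing {suc n} = numColoured-nothing {n}

one-colour-unique : ∀ {n} {G : Graph n} → Colourable G 1 → UniqueExtension G 1 (λ _ → nothing)
one-colour-unique (c , proper) = (c , proper , λ _ _ ()) , λ d d′ _ _ _ _ v → Fin1-trivial (d v) (d′ v)
  where
  Fin1-trivial : (x y : Fin 1) → x ≡ y
  Fin1-trivial zero zero = refl

mainTheorem10 : ∀ {n} (T : Graph n) → IsTree T →
    ∀ (χ k s s' : ℕ) → IsChromaticNumber T χ → χ ≤ k →
    IsSN T k s → IsSN T (suc k) s' → s ≤ s'
mainTheorem10 {zero} T (() , _) _ _ _ _ _ _ _ _
mainTheorem10 {suc n} T _ _ zero s s' _ _ ((_ , unique , _) , _) _ =
  ⊥-elim (¬Fin0 (proj₁ (proj₁ unique) zero))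
mainTheorem10 {suc n} T _ _ (suc zero) s s' _ _ ((_ , unique , _) , minimal) _ =
  ≤-trans (subst (s ≤_) (numColoured-nothing {suc n}) (minimal _ uncoloured)) z≤n
  where
  uncoloured : UniqueExtension T 1 (λ _ → nothing)
  uncoloured = one-colour-unique {G = T} (map₂ proj₁ (proj₁ unique))
mainTheorem10 {suc n} T (_ , connected , acyclic) _ (suc (suc m)) s s' _ _
              (_ , minimal) ((p′ , unique′ , count′) , _) =
  decidable-stable (s ≤? s') (¬¬-map fewer (tree-drop-colour connected acyclic unique′))
  where
  fewer : (∃ λ p → UniqueExtension T (suc (suc m)) p × numColoured p ≡ numColoured p′) → s ≤ s'
  fewer (p , unique , count) = ≤-trans (minimal p unique) (≤-reflexive (trans count count′))
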